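{- There is an undirected unweighted graph $G$ with $m$ edges such that $G-e$ has diameter $2$ or $3$ for every edge $e\in E(G)$. Any data structure that decides which one is the case (i.e., given $e$, reports whether $\mathrm{diam}(G-e)$ is $2$ or $3$) must take $\Omega(m)$ bits of space.
   Context: $G-e$ is $G$ with edge $e$ removed; $\mathrm{diam}$ is the maximum shortest-path distance over pairs of vertices. The space lower bound is in the information-theoretic sense over a family of such graphs with $m$ edges: the data structure must be able to distinguish the graphs in the family. -}

module Defs where

open import Data.Nat using (ℕ; zero; suc; _∸_)
open import Data.Fin using (Fin) renaming (_<_ to _<ᶠ_)
open import Data.Product using (_×_; _,_)
open import Data.Sum using (_⊎_)
open import Data.List using (List; length)
open import Data.List.Relation.Unary.All using (All)
open import Data.List.Relation.Unary.Unique.Propositional using (Unique)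
open import Data.List.Membership.Propositional using (_∈_)
open import Relation.Binary.PropositionalEquality using (_≡_; _≢_)
open import Relation.Nullary using (¬_)

-- A finite simple undirected graph on vertex set Fin n: each edge {u,v}
-- is stored once as the ordered pair (u , v) with u < v; no duplicates.
Edge : ℕ → Set
Edge n = Fin n × Fin n

record Graph (n : ℕ) : Set where
  field
    edges   : List (Edge n)
    ordered : All (λ { (u , v) → u <ᶠ v }) edges
    unique  : Unique edges
open Graph public

edgeCount : ∀ {n} → Graph n → ℕ
edgeCount G = length (edges G)

AdjMinus : ∀ {n} → Graph n → Edge n → Fin n → Fin n → Set
AdjMinus G e u w =
  (((u , w) ∈ edges G) × ((u , w) ≢ e)) ⊎ (((w , u) ∈ edges G) × ((w , u) ≢ e))

-- Walk R k u v : there is a walk from u to v of length at most k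
data Walk {n : ℕ} (R : Fin n → Fin n → Set) : ℕ → Fin n → Fin n → Set where
  here : ∀ {k u} → Walk R k u u
  step : ∀ {k u w v} → R u w → Walk R k w v → Walk R (suc k) u v

DiamLe : ∀ {n} → (Fin n → Fin n → Set) → ℕ → Set
DiamLe {n} R d = (u v : Fin n) → Walk R d u v

-- diam = d  (for d ≥ 1)
DiamEq : ∀ {n} → (Fin n → Fin n → Set) → ℕ → Set
DiamEq R d = DiamLe R d × ¬ DiamLe R (d ∸ 1)

DiamMinus : ∀ {n} → Graph n → Edge n → ℕ → Set
DiamMinus G e d = DiamEq (AdjMinus G e) d

{-# OPTIONS --safe #-}
-- Take vertices h, g, z, w, y and a₁ … a_b. The hub h is adjacent to every other vertex;
-- g is adjacent to w, y and every aᵢ; z only to w (and h); and aᵢ is adjacent to w if xᵢ = 0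
-- and to y if xᵢ = 1. That is 7 + 3b edges. Deleting an edge not at h keeps h as a hub, so
-- the diameter stays 2; deleting h–p keeps every pair avoiding p within 2 of each other
-- through h, so only the eccentricity of p matters. Every p has a neighbour besides h,
-- which gives eccentricity ≤ 3. It is exactly 3 when p and some t share no neighbour but h:
-- this happens for p = z, y (with t = y, z) and for p = aᵢ with xᵢ = 1 (with t = z), while
-- for xᵢ = 0 the vertex aᵢ reaches z through w. So the answers on the b query edges h–aᵢ
-- recover x, and any data structure needs b = Ω(m) bits.
module Submission where

open import Defs
open import Data.Nat using (ℕ; zero; suc; _+_; _*_; _≤_; NonZero; z≤n; z<s; s<s)
open import Data.Nat.Properties
  using (*-zeroʳ; *-suc; +-monoˡ-≤; m≤m*n; *-distribʳ-+; ≤-reflexive; ≤-trans)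
open import Data.Fin using (Fin; zero; suc; _≟_) renaming (_<_ to _<ᶠ_)
open import Data.Fin.Properties using (<-irrefl; <-asym)
open import Data.Bool using (Bool; true; false)
open import Data.Vec using (Vec; lookup)
open import Data.Product using (Σ; ∃-syntax; _×_; _,_; proj₁; proj₂)
open import Data.Sum using (_⊎_; inj₁; inj₂; swap)
open import Data.List using (List; []; _∷_; _++_; map; concatMap; length; allFin; tabulate)
open import Data.List.Properties using (length-++; length-map)
open import Data.List.Membership.Propositional using (_∈_)
open import Data.List.Membership.Propositional.Properties
  using (∈-map⁺; ∈-map⁻; ∈-concatMap⁺; ∈-concatMap⁻; ∈-allFin)
open import Data.List.Relation.Unary.Any using (here; there; satisfied)
import Data.List.Relation.Unary.Any as Any
import Data.List.Relation.Unary.All as All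
import Data.List.Relation.Unary.All.Properties as All
import Data.List.Relation.Unary.AllPairs as AllPairs
import Data.List.Relation.Unary.AllPairs.Properties as AllPairs
open import Data.List.Relation.Unary.Unique.Propositional using (Unique)
open import Data.List.Relation.Unary.All using ([]; _∷_)
open import Data.List.Relation.Unary.AllPairs using ([]; _∷_)
import Data.List.Relation.Unary.Unique.Propositional.Properties as Unique
open import Data.List.Relation.Binary.Disjoint.Propositional using (Disjoint)
open import Data.Empty using (⊥)
open import Relation.Nullary using (¬_; yes; no; contradiction)
open import Relation.Binary.PropositionalEquality
  using (_≡_; _≢_; refl; sym; trans; cong; cong₂; module ≡-Reasoning)
open import Function using (_∘_)
open import Function.Bundles using (_⇔_; mk⇔; Equivalence)

EccLe : ∀ {n} → (Fin n → Fin n → Set) → ℕ → Fin n → Set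
EccLe R k p = ∀ v → Walk R k p v

module _ {n : ℕ} {R : Fin n → Fin n → Set} where

  Walk-snoc : ∀ {k u v t} → Walk R k u v → R v t → Walk R (suc k) u t
  Walk-snoc here r = step r here
  Walk-snoc (step r w) s = step r (Walk-snoc w s)

  Walk-reverse : (∀ {u v} → R u v → R v u) → ∀ {k u v} → Walk R k u v → Walk R k v u
  Walk-reverse sym here = here
  Walk-reverse sym (step r w) = Walk-snoc (Walk-reverse sym w) (sym r)

  ¬Walk₂ : ∀ {u v} → u ≢ v → ¬ R u v → (∀ {w} → R u w → R w v → ⊥) → ¬ Walk R 2 u v
  ¬Walk₂ u≢v _ _ here = u≢v refl
  ¬Walk₂ _ ¬r _ (step r here) = ¬r r
  ¬Walk₂ _ _ noCommon (step r (step s here)) = noCommon r s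

  module Hub (sym : ∀ {u v} → R u v → R v u) (h p : Fin n)
             (hub : ∀ {v} → v ≢ p → v ≢ h → R h v) where

    diamLe : ∀ {k} → EccLe R (2 + k) p → DiamLe R (2 + k)
    diamLe ecc u v with u ≟ p | v ≟ p
    ... | yes refl | _ = ecc v
    ... | no _ | yes refl = Walk-reverse sym (ecc u)
    ... | no u≢p | no v≢p with u ≟ h | v ≟ h
    ... | yes refl | yes refl = here
    ... | yes refl | no v≢h = step (hub v≢p v≢h) here
    ... | no u≢h | yes refl = step (sym (hub u≢p u≢h)) here
    ... | no u≢h | no v≢h = step (sym (hub u≢p u≢h)) (step (hub v≢p v≢h) here)

    eccLe₃ : ∀ {q} → R p q → q ≢ p → q ≢ h → EccLe R 3 p
    eccLe₃ {q} r q≢p q≢h v with v ≟ p | v ≟ h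
    ... | yes refl | _ = here
    ... | no _ | yes refl = step r (step (sym (hub q≢p q≢h)) here)
    ... | no v≢p | no v≢h = step r (step (sym (hub q≢p q≢h)) (step (hub v≢p v≢h) here))

module _ {n : ℕ} (G : Graph n) where

  AdjMinus-sym : ∀ e {u v} → AdjMinus G e u v → AdjMinus G e v u
  AdjMinus-sym _ = swap

  ¬DiamLe₁ : ∀ {u v} → (u , v) ∈ edges G → ¬ DiamLe (AdjMinus G (u , v)) 1
  ¬DiamLe₁ {u} {v} uv∈G diam = ¬walk (diam u v)
    where
    u<v = All.lookup (ordered G) uv∈G
    ¬walk : ¬ Walk (AdjMinus G (u , v)) 1 u v
    ¬walk here = <-irrefl refl u<v
    ¬walk (step (inj₁ (_ , uv≢uv)) here) = uv≢uv refl
    ¬walk (step (inj₂ (vu∈G , _)) here) = <-asym u<v (All.lookup (ordered G) vu∈G)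

module _ {A B : Set} (src : B → List A) where

  edgesInto : B → List (A × B)
  edgesInto v = map (_, v) (src v)

  inEdges : List B → List (A × B)
  inEdges = concatMap edgesInto

  ∈-inEdges⁺ : ∀ {u v vs} → v ∈ vs → u ∈ src v → (u , v) ∈ inEdges vs
  ∈-inEdges⁺ {v = v} v∈vs u∈src =
    ∈-concatMap⁺ edgesInto (Any.map (λ { refl → ∈-map⁺ (_, v) u∈src }) v∈vs)

  ∈-inEdges⁻ : ∀ {u v} vs → (u , v) ∈ inEdges vs → u ∈ src v
  ∈-inEdges⁻ vs uv∈ with satisfied (∈-concatMap⁻ edgesInto {xs = vs} uv∈)
  ... | w , uv∈map with ∈-map⁻ (_, w) uv∈map
  ... | _ , u∈src , refl = u∈src

  inEdges-unique : ∀ {vs} → Unique vs → (∀ v → Unique (src v)) → Unique (inEdges vs)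
  inEdges-unique vs! src! =
    Unique.concat⁺ (All.map⁺ (All.universal (λ v → Unique.map⁺ (cong proj₁) (src! v)) _))
                   (AllPairs.map⁺ (AllPairs.map disjoint vs!))
    where
    disjoint : ∀ {v v′} → v ≢ v′ → Disjoint (edgesInto v) (edgesInto v′)
    disjoint {v} {v′} v≢v′ (e∈ , e∈′) with ∈-map⁻ (_, v) e∈ | ∈-map⁻ (_, v′) e∈′
    ... | _ , _ , refl | _ , _ , refl = v≢v′ refl

  length-inEdges-tabulate : ∀ {k} m (f : Fin m → B) → (∀ i → length (src (f i)) ≡ k) →
                            length (inEdges (tabulate f)) ≡ k * m
  length-inEdges-tabulate {k} zero f _ = sym (*-zeroʳ k)
  length-inEdges-tabulate {k} (suc m) f len = begin
    length (edgesInto (f zero) ++ inEdges (tabulate (f ∘ suc)))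
      ≡⟨ length-++ (edgesInto (f zero)) ⟩
    length (edgesInto (f zero)) + length (inEdges (tabulate (f ∘ suc)))
      ≡⟨ cong₂ _+_ (trans (length-map _ (src (f zero))) (len zero))
                   (length-inEdges-tabulate m (f ∘ suc) (len ∘ suc)) ⟩
    k + k * m
      ≡⟨ sym (*-suc k m) ⟩
    k * suc m ∎
    where open ≡-Reasoning

pattern vh = zero
pattern vg = suc zero
pattern vz = suc (suc zero)
pattern vw = suc (suc (suc zero))
pattern vy = suc (suc (suc (suc zero)))
pattern va i = suc (suc (suc (suc (suc i))))

module Construction {b : ℕ} (x : Vec Bool b) where

  V : Set
  V = Fin (5 + b)

  side : Bool → V
  side false = vw
  side true = vy

  -- sources v lists the neighbours of v below it, so each edge (u , v) with u < v occurs once.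
  sources : V → List V
  sources vh = []
  sources vg = vh ∷ []
  sources vz = vh ∷ []
  sources vw = vh ∷ vg ∷ vz ∷ []
  sources vy = vh ∷ vg ∷ []
  sources (va i) = vh ∷ vg ∷ side (lookup x i) ∷ []

  data Adj : V → V → Set where
    h— : ∀ {v} → Adj vh (suc v)
    g—w : Adj vg vw
    g—y : Adj vg vy
    g—a : ∀ i → Adj vg (va i)
    z—w : Adj vz vw
    w—a : ∀ i → lookup x i ≡ false → Adj vw (va i)
    y—a : ∀ i → lookup x i ≡ true → Adj vy (va i)

  sources⇒Adj : ∀ {u v} → u ∈ sources v → Adj u v
  sources⇒Adj {v = vg} (here refl) = h—
  sources⇒Adj {v = vz} (here refl) = h—
  sources⇒Adj {v = vw} (here refl) = h—
  sources⇒Adj {v = vw} (there (here refl)) = g—w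
  sources⇒Adj {v = vw} (there (there (here refl))) = z—w
  sources⇒Adj {v = vy} (here refl) = h—
  sources⇒Adj {v = vy} (there (here refl)) = g—y
  sources⇒Adj {v = va i} (here refl) = h—
  sources⇒Adj {v = va i} (there (here refl)) = g—a i
  sources⇒Adj {v = va i} (there (there (here refl))) with lookup x i in eq
  ... | false = w—a i eq
  ... | true = y—a i eq

  Adj⇒sources : ∀ {u v} → Adj u v → u ∈ sources v
  Adj⇒sources {v = vg} h— = here refl
  Adj⇒sources {v = vz} h— = here refl
  Adj⇒sources {v = vw} h— = here refl
  Adj⇒sources {v = vy} h— = here refl
  Adj⇒sources {v = va i} h— = here refl
  Adj⇒sources g—w = there (here refl)
  Adj⇒sources g—y = there (here refl)
  Adj⇒sources (g—a i) = there (here refl)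
  Adj⇒sources z—w = there (there (here refl))
  Adj⇒sources (w—a i eq) rewrite eq = there (there (here refl))
  Adj⇒sources (y—a i eq) rewrite eq = there (there (here refl))

  Adj⇒< : ∀ {u v} → Adj u v → u <ᶠ v
  Adj⇒< h— = z<s
  Adj⇒< g—w = s<s z<s
  Adj⇒< g—y = s<s z<s
  Adj⇒< (g—a i) = s<s z<s
  Adj⇒< z—w = s<s (s<s z<s)
  Adj⇒< (w—a i _) = s<s (s<s (s<s z<s))
  Adj⇒< (y—a i _) = s<s (s<s (s<s (s<s z<s)))

  sources-unique : ∀ v → Unique (sources v)
  sources-unique vh = []
  sources-unique vg = [] ∷ []
  sources-unique vz = [] ∷ []
  sources-unique vw = ((λ ()) ∷ (λ ()) ∷ []) ∷ ((λ ()) ∷ []) ∷ [] ∷ []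
  sources-unique vy = ((λ ()) ∷ []) ∷ [] ∷ []
  sources-unique (va i) with lookup x i
  ... | false = ((λ ()) ∷ (λ ()) ∷ []) ∷ ((λ ()) ∷ []) ∷ [] ∷ []
  ... | true = ((λ ()) ∷ (λ ()) ∷ []) ∷ ((λ ()) ∷ []) ∷ [] ∷ []

  edgeList : List (Edge (5 + b))
  edgeList = inEdges sources (allFin (5 + b))

  edgeList⇒Adj : ∀ {u v} → (u , v) ∈ edgeList → Adj u v
  edgeList⇒Adj uv∈ = sources⇒Adj (∈-inEdges⁻ sources (allFin (5 + b)) uv∈)

  G : Graph (5 + b)
  G = record
    { edges = edgeList
    ; ordered = All.tabulate λ { {u , v} uv∈ → Adj⇒< (edgeList⇒Adj uv∈) }
    ; unique = inEdges-unique sources (Unique.allFin⁺ (5 + b)) sources-unique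
    }

  Adj⇒edges : ∀ {u v} → Adj u v → (u , v) ∈ edges G
  Adj⇒edges {v = v} uv = ∈-inEdges⁺ sources (∈-allFin v) (Adj⇒sources uv)

  edgeCount-G : edgeCount G ≡ 7 + 3 * b
  edgeCount-G = cong (7 +_) (length-inEdges-tabulate sources b va′ (λ _ → refl))
    where
    va′ : Fin b → V
    va′ i = va i

  Link : V → V → Set
  Link u v = Adj u v ⊎ Adj v u

  ¬Adj-hub : ∀ {u} → ¬ Adj u vh
  ¬Adj-hub ()

  commonNeighbour-z-y : ∀ {w} → Link vz w → Link w vy → w ≡ vh
  commonNeighbour-z-y (inj₁ z—w) (inj₁ ())
  commonNeighbour-z-y (inj₁ z—w) (inj₂ ())
  commonNeighbour-z-y (inj₂ h—) _ = refl

  commonNeighbour-a-z : ∀ {i w} → lookup x i ≡ true → Link (va i) w → Link w vz → w ≡ vh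
  commonNeighbour-a-z _ (inj₁ ()) _
  commonNeighbour-a-z _ (inj₂ h—) _ = refl
  commonNeighbour-a-z _ (inj₂ (g—a i)) (inj₁ ())
  commonNeighbour-a-z _ (inj₂ (g—a i)) (inj₂ ())
  commonNeighbour-a-z xᵢ≡true (inj₂ (w—a i xᵢ≡false)) _ =
    contradiction (trans (sym xᵢ≡true) xᵢ≡false) λ ()
  commonNeighbour-a-z _ (inj₂ (y—a i _)) (inj₁ ())
  commonNeighbour-a-z _ (inj₂ (y—a i _)) (inj₂ ())

  AdjMinus⇒Link : ∀ {e u v} → AdjMinus G e u v → Link u v
  AdjMinus⇒Link (inj₁ (uv∈ , _)) = inj₁ (edgeList⇒Adj uv∈)
  AdjMinus⇒Link (inj₂ (vu∈ , _)) = inj₂ (edgeList⇒Adj vu∈)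

  kept : ∀ {e u v} → Adj u v → (u , v) ≢ e → AdjMinus G e u v
  kept uv ≢e = inj₁ (Adj⇒edges uv , ≢e)

  kept˘ : ∀ {e u v} → Adj u v → (u , v) ≢ e → AdjMinus G e v u
  kept˘ uv ≢e = inj₂ (Adj⇒edges uv , ≢e)

  hubKept : ∀ {e v} → (vh , v) ≢ e → v ≢ vh → AdjMinus G e vh v
  hubKept {v = vh} _ v≢h = contradiction refl v≢h
  hubKept {v = suc _} ≢e _ = kept h— ≢e

  diam-nonHub≡2 : ∀ {u v} → Adj u v → u ≢ vh → DiamMinus G (u , v) 2
  diam-nonHub≡2 {u} {v} uv u≢h =
    Hub.diamLe {R = AdjMinus G (u , v)} (AdjMinus-sym G (u , v)) vh vh hub ecc ,
    ¬DiamLe₁ G (Adj⇒edges uv)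
    where
    hub : ∀ {w} → w ≢ vh → w ≢ vh → AdjMinus G (u , v) vh w
    hub _ = hubKept (λ eq → u≢h (sym (cong proj₁ eq)))
    ecc : EccLe (AdjMinus G (u , v)) 2 vh
    ecc vh = here
    ecc (suc w) = step (hub (λ ()) (λ ())) here

  module HubEdge (p : V) where

    R : V → V → Set
    R = AdjMinus G (vh , p)

    hub : ∀ {v} → v ≢ p → v ≢ vh → R vh v
    hub v≢p = hubKept λ eq → v≢p (cong proj₂ eq)

    open Hub {R = R} (AdjMinus-sym G (vh , p)) vh p hub public

    ¬R-hub : ¬ R p vh
    ¬R-hub (inj₁ (p-hub∈ , _)) = ¬Adj-hub (edgeList⇒Adj p-hub∈)
    ¬R-hub (inj₂ (_ , ≢e)) = ≢e refl

    -- Only the removed edge could have made h a common neighbour of p and t.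
    ¬diamLe₂ : ∀ {t} → p ≢ t → ¬ Link p t → (∀ {w} → Link p w → Link w t → w ≡ vh) →
               ¬ DiamLe R 2
    ¬diamLe₂ {t} p≢t ¬pt onlyHub diam = ¬Walk₂ p≢t (¬pt ∘ AdjMinus⇒Link) noCommon (diam p t)
      where
      noCommon : ∀ {w} → R p w → R w t → ⊥
      noCommon r s with onlyHub (AdjMinus⇒Link r) (AdjMinus⇒Link s)
      ... | refl = ¬R-hub r

  diam-h-g≡2 : DiamMinus G (vh , vg) 2
  diam-h-g≡2 = diamLe ecc , ¬DiamLe₁ G (Adj⇒edges h—)
    where
    open HubEdge vg
    ecc : EccLe R 2 vg
    ecc vh = step (kept g—w (λ ())) (step (kept˘ h— (λ ())) here)
    ecc vg = here
    ecc vz = step (kept g—w (λ ())) (step (kept˘ z—w (λ ())) here)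
    ecc vw = step (kept g—w (λ ())) here
    ecc vy = step (kept g—y (λ ())) here
    ecc (va j) = step (kept (g—a j) (λ ())) here

  diam-h-w≡2 : DiamMinus G (vh , vw) 2
  diam-h-w≡2 = diamLe ecc , ¬DiamLe₁ G (Adj⇒edges h—)
    where
    open HubEdge vw
    ecc : EccLe R 2 vw
    ecc vh = step (kept˘ g—w (λ ())) (step (kept˘ h— (λ ())) here)
    ecc vg = step (kept˘ g—w (λ ())) here
    ecc vz = step (kept˘ z—w (λ ())) here
    ecc vw = here
    ecc vy = step (kept˘ g—w (λ ())) (step (kept g—y (λ ())) here)
    ecc (va j) = step (kept˘ g—w (λ ())) (step (kept (g—a j) (λ ())) here)

  diam-h-a≡2 : ∀ {i} → lookup x i ≡ false → DiamMinus G (vh , va i) 2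
  diam-h-a≡2 {i} xᵢ≡false = diamLe ecc , ¬DiamLe₁ G (Adj⇒edges h—)
    where
    open HubEdge (va i)
    ecc : EccLe R 2 (va i)
    ecc vh = step (kept˘ (g—a i) (λ ())) (step (kept˘ h— (λ ())) here)
    ecc vg = step (kept˘ (g—a i) (λ ())) here
    ecc vz = step (kept˘ (w—a i xᵢ≡false) (λ ())) (step (kept˘ z—w (λ ())) here)
    ecc vw = step (kept˘ (w—a i xᵢ≡false) (λ ())) here
    ecc vy = step (kept˘ (g—a i) (λ ())) (step (kept g—y (λ ())) here)
    ecc (va j) = step (kept˘ (g—a i) (λ ())) (step (kept (g—a j) (λ ())) here)

  diam-h-z≡3 : DiamMinus G (vh , vz) 3
  diam-h-z≡3 = diamLe (eccLe₃ (kept z—w (λ ())) (λ ()) (λ ())) ,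
               ¬diamLe₂ (λ ()) (λ { (inj₁ ()) ; (inj₂ ()) }) commonNeighbour-z-y
    where open HubEdge vz

  diam-h-y≡3 : DiamMinus G (vh , vy) 3
  diam-h-y≡3 = diamLe (eccLe₃ (kept˘ g—y (λ ())) (λ ()) (λ ())) ,
               ¬diamLe₂ (λ ()) (λ { (inj₁ ()) ; (inj₂ ()) })
                        (λ l₁ l₂ → commonNeighbour-z-y (swap l₂) (swap l₁))
    where open HubEdge vy

  diam-h-a≡3⇔ : ∀ i → DiamMinus G (vh , va i) 3 ⇔ (lookup x i ≡ true)
  diam-h-a≡3⇔ i = mk⇔ to from
    where
    open HubEdge (va i)
    to : DiamMinus G (vh , va i) 3 → lookup x i ≡ true
    to (_ , ¬diam₂) with lookup x i in xᵢ
    ... | true = refl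
    ... | false = contradiction (proj₁ (diam-h-a≡2 xᵢ)) ¬diam₂
    from : lookup x i ≡ true → DiamMinus G (vh , va i) 3
    from xᵢ≡true = diamLe (eccLe₃ (kept˘ (g—a i) (λ ())) (λ ()) (λ ())) ,
                   ¬diamLe₂ (λ ()) (λ { (inj₁ ()) ; (inj₂ ()) }) (commonNeighbour-a-z xᵢ≡true)

  diam≡2⊎3 : ∀ {u v} → Adj u v → DiamMinus G (u , v) 2 ⊎ DiamMinus G (u , v) 3
  diam≡2⊎3 {u} uv with u ≟ vh
  ... | no u≢h = inj₁ (diam-nonHub≡2 uv u≢h)
  ... | yes refl = hubEdge uv
    where
    hubEdge : ∀ {v} → Adj vh v → DiamMinus G (vh , v) 2 ⊎ DiamMinus G (vh , v) 3
    hubEdge {vg} h— = inj₁ diam-h-g≡2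
    hubEdge {vz} h— = inj₂ diam-h-z≡3
    hubEdge {vw} h— = inj₁ diam-h-w≡2
    hubEdge {vy} h— = inj₂ diam-h-y≡3
    hubEdge {va i} h— with lookup x i in xᵢ
    ... | true = inj₂ (Equivalence.from (diam-h-a≡3⇔ i) xᵢ)
    ... | false = inj₁ (diam-h-a≡2 xᵢ)

open Construction using (G; edgeCount-G; edgeList⇒Adj; Adj⇒edges; h—; diam≡2⊎3; diam-h-a≡3⇔)

emptyGraph : Graph 0
emptyGraph = record { edges = [] ; ordered = [] ; unique = [] }

edgeCount-bound : ∀ n .{{_ : NonZero n}} → 7 + 3 * n ≤ 10 * n
edgeCount-bound n =
  ≤-trans (+-monoˡ-≤ (3 * n) (m≤m*n 7 n)) (≤-reflexive (sym (*-distribʳ-+ n 7 3)))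

lemma12 : ∃[ c ] ((b : ℕ) → ∃[ n ] ∃[ m ] ((m ≤ c * b) ×
            Σ (Vec Bool b → Graph n) (λ G →
              ((x : Vec Bool b) → edgeCount (G x) ≡ m) ×
              ((x : Vec Bool b) (e : Edge n) → e ∈ edges (G x) →
                 DiamMinus (G x) e 2 ⊎ DiamMinus (G x) e 3) ×
              Σ (Fin b → Edge n) (λ q →
                ((x : Vec Bool b) (i : Fin b) → q i ∈ edges (G x)) ×
                ((x : Vec Bool b) (i : Fin b) →
                   DiamMinus (G x) (q i) 3 ⇔ (lookup x i ≡ true))))))
lemma12 = 10 , λ where
  -- m ≤ c * 0 forces the empty graph, which has no edges and no queries.
  zero → 0 , 0 , z≤n , (λ _ → emptyGraph) , (λ _ → refl) , (λ _ _ ()) , (λ ()) , (λ _ ()) , (λ _ ())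
  b@(suc _) → 5 + b , 7 + 3 * b , edgeCount-bound b , G , edgeCount-G ,
    (λ x _ e∈ → diam≡2⊎3 x (edgeList⇒Adj x e∈)) ,
    (λ i → vh , va i) , (λ x _ → Adj⇒edges x h—) , diam-h-a≡3⇔
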